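{- Let $B$ be a balanced polygon in $\mathbb{R}^2$ all of whose vertices have integer coordinates. Then there exist integers $\mu_1,\mu_2,\mu_3$ such that $$\langle\partial B\rangle=\mu_1(\sigma_2+\sigma_3)+\mu_2(\sigma_3+\sigma_1)+\mu_3(\sigma_1+\sigma_2)$$ in $H_1(K_4,\mathbb{Z})$ (so $\langle\partial B\rangle$ lies in the index-$2$ subgroup generated by $\sigma_2+\sigma_3,\sigma_3+\sigma_1,\sigma_1+\sigma_2$), and moreover $\mathrm{Area}(B)\equiv\mu_1+\mu_2+\mu_3 \pmod 2$.
   Context: A plane polygon $B$ with clockwise-oriented boundary is balanced if its edges (oriented by the boundary orientation) can be divided into pairs so that in each pair the edges are parallel, equal in length and have opposite orientations. $K_4$ is the complete graph on vertices $X_1=(0,0),X_2=(0,1),X_3=(1,0),X_4=(1,1)\in\mathbb{Z}_2\times\mathbb{Z}_2$, viewed as a $1$-dimensional simplicial complex; $H_1(K_4,\mathbb{Z})\cong\mathbb{Z}^3$ is freely generated by $\sigma_1=X_1X_2+X_2X_3+X_3X_1$, $\sigma_2=X_1X_3+X_3X_4+X_4X_1$, $\sigma_3=X_3X_2+X_4X_3+X_2X_4$. For a closed broken line $L$ with integer vertices, reducing coordinates mod $2$ and extending linearly on edges gives a simplicial map $L\to K_4$, and $\langle L\rangle$ is the image in $H_1(K_4,\mathbb{Z})$ of the generator of $H_1(L,\mathbb{Z})\cong\mathbb{Z}$. $\partial B$ is the boundary of $B$ as a closed broken line. For a closed broken line $L=L_1\dots L_n$ (with $L_{n+1}:=L_1$),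 $\mathrm{Area}(L)=\frac12\sum_{i=1}^n \overline{OL_i}\wedge\overline{OL_{i+1}}$, where $v\wedge w=v_xw_y-v_yw_x$; $\mathrm{Area}(B)$ means $\mathrm{Area}(\partial B)$, the oriented area of $B$. -}

module Defs where

open import Data.Nat as ℕ using (ℕ; zero; suc)
open import Data.Nat.DivMod using (_mod_)
open import Data.Fin as Fin using (Fin; toℕ)
open import Data.Integer using (ℤ; +_; _+_; _-_; _*_; -_; _%ℕ_; _≤_; _<_)
open import Data.Product using (_×_; _,_; proj₁; proj₂; Σ; ∃)
open import Data.Product.Properties using (≡-dec)
open import Data.Bool using (if_then_else_)
open import Relation.Nullary using (¬_; ⌊_⌋)
open import Relation.Nullary.Decidable using (_×-dec_)
open import Relation.Binary.PropositionalEquality using (_≡_; _≢_)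

Point : Set
Point = ℤ × ℤ

_-ᵖ_ : Point → Point → Point
(a , b) -ᵖ (c , d) = (a - c , b - d)

-ᵖ_ : Point → Point
-ᵖ (a , b) = (- a , - b)

_∧_ : Point → Point → ℤ
(a , b) ∧ (c , d) = a * d - b * c

Σℤ : (n : ℕ) → (Fin n → ℤ) → ℤ
Σℤ zero    f = + 0
Σℤ (suc n) f = f Fin.zero + Σℤ n (λ i → f (Fin.suc i))

-- A closed broken line with n = 3 + k vertices V 0, …, V (n-1);
-- its edges are V i → V (nxt i) with indices taken cyclically.
nxt : (k : ℕ) → Fin (3 ℕ.+ k) → Fin (3 ℕ.+ k)
nxt k i = suc (toℕ i) mod (3 ℕ.+ k)

edge : (k : ℕ) → (Fin (3 ℕ.+ k) → Point) → Fin (3 ℕ.+ k) → Point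
edge k V i = V (nxt k i) -ᵖ V i

-- 2·Area(L) = Σ_i  OL_i ∧ OL_{i+1}   (shoelace formula, as in the paper)
doubleArea : (k : ℕ) → (Fin (3 ℕ.+ k) → Point) → ℤ
doubleArea k V = Σℤ (3 ℕ.+ k) (λ i → V i ∧ V (nxt k i))

-- Segments [P,Q] and [R,S] share a point: there are rationals s = a/d,
-- t = b/d in [0,1] with P + s(Q-P) = R + t(S-R).  (Intersections of
-- segments with integer endpoints always contain a rational point.)
CommonParam : Point → Point → Point → Point → ℤ → ℤ → ℤ → Set
CommonParam (p₁ , p₂) (q₁ , q₂) (r₁ , r₂) (s₁ , s₂) a b d =
  (+ 0 < d) × (+ 0 ≤ a) × (a ≤ d) × (+ 0 ≤ b) × (b ≤ d) ×
  (d * p₁ + a * (q₁ - p₁) ≡ d * r₁ + b * (s₁ - r₁)) ×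
  (d * p₂ + a * (q₂ - p₂) ≡ d * r₂ + b * (s₂ - r₂))

-- Simple (non-self-intersecting) polygon:
--  * consecutive edges [V i, V (i+1)] and [V (i+1), V (i+2)] meet only at V (i+1)
--    (parameter a/d = 1 on the first, b/d = 0 on the second); this also
--    forces every edge to be non-degenerate;
--  * non-adjacent edges are disjoint.
IsSimple : (k : ℕ) → (Fin (3 ℕ.+ k) → Point) → Set
IsSimple k V =
  (∀ i a b d →
     CommonParam (V i) (V (nxt k i)) (V (nxt k i)) (V (nxt k (nxt k i))) a b d →
     (a ≡ d) × (b ≡ + 0)) ×
  (∀ i j → i ≢ j → j ≢ nxt k i → i ≢ nxt k j → ∀ a b d →
     ¬ CommonParam (V i) (V (nxt k i)) (V j) (V (nxt k j)) a b d)

IsClockwise : (k : ℕ) → (Fin (3 ℕ.+ k) → Point) → Set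
IsClockwise k V = doubleArea k V < + 0

-- Balanced: the edges can be divided into pairs (a fixed-point-free
-- involution π on edge indices) such that paired edges are parallel, of
-- equal length and of opposite orientation, i.e. edge (π i) = - edge i.
IsBalanced : (k : ℕ) → (Fin (3 ℕ.+ k) → Point) → Set
IsBalanced k V =
  Σ (Fin (3 ℕ.+ k) → Fin (3 ℕ.+ k)) λ π →
    (∀ i → π (π i) ≡ i) × (∀ i → π i ≢ i) ×
    (∀ i → edge k V (π i) ≡ -ᵖ edge k V i)

K4V : Set
K4V = Fin 2 × Fin 2

X₁ X₂ X₃ X₄ : K4V
X₁ = (Fin.zero , Fin.zero)
X₂ = (Fin.zero , Fin.suc Fin.zero)
X₃ = (Fin.suc Fin.zero , Fin.zero)
X₄ = (Fin.suc Fin.zero , Fin.suc Fin.zero)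

_≟V_ : (x y : K4V) → Relation.Nullary.Dec (x ≡ y)
_≟V_ = ≡-dec Fin._≟_ Fin._≟_

red₂ : ℤ → Fin 2
red₂ z = (z %ℕ 2) mod 2

red : Point → K4V
red (x , y) = (red₂ x , red₂ y)

-- Integral 1-chains of K₄, recorded as the (antisymmetric) coefficient
-- c x y of the oriented edge x → y.  Since K₄ is 1-dimensional,
-- H₁(K₄,ℤ) = Z₁(K₄) ⊆ C₁(K₄), so equality in H₁ is equality of chains.
Chain : Set
Chain = K4V → K4V → ℤ

[_] : ∀ {A : Set} → Relation.Nullary.Dec A → ℤ
[ d ] = if ⌊ d ⌋ then + 1 else + 0

seg : K4V → K4V → Chain
seg p q x y = [ (p ≟V x) ×-dec (q ≟V y) ] - [ (q ≟V x) ×-dec (p ≟V y) ]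

_⊕_ : Chain → Chain → Chain
(c ⊕ c') x y = c x y + c' x y

_⊙_ : ℤ → Chain → Chain
(m ⊙ c) x y = m * c x y

infixl 6 _⊕_
infixl 7 _⊙_

σ₁ σ₂ σ₃ : Chain
σ₁ = seg X₁ X₂ ⊕ seg X₂ X₃ ⊕ seg X₃ X₁
σ₂ = seg X₁ X₃ ⊕ seg X₃ X₄ ⊕ seg X₄ X₁
σ₃ = seg X₃ X₂ ⊕ seg X₄ X₃ ⊕ seg X₂ X₄

-- ⟨L⟩ : image of the fundamental class of L under the mod-2 reduction map.
⟨_⟩ : ∀ {k} → (Fin (3 ℕ.+ k) → Point) → Chain
⟨_⟩ {k} V x y = Σℤ (3 ℕ.+ k) (λ i → seg (red (V i)) (red (V (nxt k i))) x y)

-- Reducing the vertices mod 2 maps ∂B to a cycle of K₄. Closing each reduced edge p q through the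
-- spanning star at X₁ writes it as (star q − star p) plus a fixed combination of σ₁ σ₂ σ₃; the star
-- terms telescope around the boundary, so ⟨∂B⟩ = a₁σ₁ + a₂σ₂ + a₃σ₃ with aⱼ the summed coefficients.
-- For the area, let s = ±1 and cubic s (x , y) = x²y − s·xy². For all integer points P, Q,
--   P ∧ Q ≡ (cubic s Q − cubic s P) + cubic s (Q − P) + s · (contribution of P Q to a₁ + a₂ + a₃)  (mod 4),
-- which only depends on P, Q mod 4 and is checked on residues. Summed around the boundary the first
-- bracket telescopes, and since the cubic is odd its values on opposite edges of a balanced polygon
-- cancel. So 2·Area ≡ ±(a₁ + a₂ + a₃) (mod 4) for both signs: a₁ + a₂ + a₃ = 2S is even,
-- 2·Area ≡ 2S (mod 4), and μⱼ = S − aⱼ satisfies aⱼ = μₖ + μₗ for {j, k, l} = {1, 2, 3} and Σ μⱼ = S.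
module Submission where

open import Defs
open import Data.Nat using (ℕ)
open import Data.Fin using (Fin)
open import Data.Integer using (ℤ; +_; _+_; _*_)
open import Data.Product using (_×_; ∃; ∃-syntax)
open import Relation.Binary.PropositionalEquality using (_≡_)

import Data.Nat as ℕ
import Data.Nat.DivMod as ℕ
import Data.Nat.Divisibility as ℕ
import Data.Fin as Fin
import Data.Fin.Properties as Fin
open import Data.Fin.Patterns using (0F; 1F)
open import Data.Fin.Permutation using (permutation)
open import Data.Integer using (-_; _-_; 1ℤ; -1ℤ; -[1+_]; _◃_; _/ℕ_; _%ℕ_; ∣_∣)
import Data.Integer.Properties as ℤ
open import Data.Integer.DivMod using (a≡a%ℕn+[a/ℕn]*n; n%ℕd<d)
open import Data.Integer.Divisibility.Signed
  using (_∣_; divides; ∣ᵤ⇒∣; ∣⇒∣ᵤ; ∣m∣n⇒∣m+n; ∣n⇒∣m*n; ∣m⇒∣m*n)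
open import Data.Integer.Tactic.RingSolver using (solve-∀)
open import Data.Sign using (Sign)
open import Data.Product using (_,_; proj₁; proj₂)
open import Data.Vec.Functional using (Vector)
open import Function using (_∘_)
open import Relation.Nullary using (Dec)
open import Relation.Nullary.Decidable using (map′; toWitness)
open import Relation.Binary.PropositionalEquality
  using (refl; sym; trans; cong; cong₂; subst; subst₂; module ≡-Reasoning)
open import Algebra.Properties.Semiring.Sum ℤ.+-*-semiring
  using (sum; sum-cong-≗; sum-init-last; sum-permute; ∑-distrib-+; *-distribˡ-sum; *-distribʳ-sum)

open ≡-Reasoning

Σℤ≡sum : ∀ n (f : Fin n → ℤ) → Σℤ n f ≡ sum f
Σℤ≡sum ℕ.zero    f = refl
Σℤ≡sum (ℕ.suc n) f = cong (_+_ (f 0F)) (Σℤ≡sum n (f ∘ Fin.suc))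

sum-neg : ∀ {n} (f : Vector ℤ n) → sum (λ i → - f i) ≡ - sum f
sum-neg {ℕ.zero}  f = refl
sum-neg {ℕ.suc n} f = begin
  - f 0F + sum (λ i → - f (Fin.suc i)) ≡⟨ cong (_+_ (- f 0F)) (sum-neg (f ∘ Fin.suc)) ⟩
  - f 0F - sum (f ∘ Fin.suc)           ≡⟨ ℤ.neg-distrib-+ (f 0F) _ ⟨
  - sum f                              ∎

sum-involution : ∀ {n} (π : Fin n → Fin n) → (∀ i → π (π i) ≡ i) →
                 (f : Vector ℤ n) → sum (f ∘ π) ≡ sum f
sum-involution π π∘π≡id f = sym (sum-permute f (permutation π π π∘π≡id π∘π≡id))

i≡-i⇒i≡0 : ∀ x → x ≡ - x → x ≡ + 0
i≡-i⇒i≡0 (+ ℕ.zero)  _  = refl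
i≡-i⇒i≡0 (+ ℕ.suc n) ()
i≡-i⇒i≡0 -[1+ n ]    ()

module _ (k : ℕ) where

  nxt-inject₁ : ∀ (i : Fin (2 ℕ.+ k)) → nxt k (Fin.inject₁ i) ≡ Fin.suc i
  nxt-inject₁ i = Fin.toℕ-injective (begin
    Fin.toℕ (nxt k (Fin.inject₁ i))                ≡⟨ Fin.toℕ-fromℕ< _ ⟩
    ℕ.suc (Fin.toℕ (Fin.inject₁ i)) ℕ.% (3 ℕ.+ k) 
      ≡⟨ cong (λ m → ℕ.suc m ℕ.% (3 ℕ.+ k)) (Fin.toℕ-inject₁ i) ⟩
    ℕ.suc (Fin.toℕ i) ℕ.% (3 ℕ.+ k)               ≡⟨ ℕ.m<n⇒m%n≡m (ℕ.s≤s (Fin.toℕ<n i)) ⟩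
    ℕ.suc (Fin.toℕ i)                              ∎)

  nxt-last : nxt k (Fin.fromℕ (2 ℕ.+ k)) ≡ 0F
  nxt-last = Fin.toℕ-injective (begin
    Fin.toℕ (nxt k (Fin.fromℕ (2 ℕ.+ k)))               ≡⟨ Fin.toℕ-fromℕ< _ ⟩
    ℕ.suc (Fin.toℕ (Fin.fromℕ (2 ℕ.+ k))) ℕ.% (3 ℕ.+ k)
      ≡⟨ cong (λ m → ℕ.suc m ℕ.% (3 ℕ.+ k)) (Fin.toℕ-fromℕ (2 ℕ.+ k)) ⟩
    (3 ℕ.+ k) ℕ.% (3 ℕ.+ k)                             ≡⟨ ℕ.n%n≡0 (3 ℕ.+ k) ⟩
    0                                                    ∎)

  sum-rotate : (f : Vector ℤ (3 ℕ.+ k)) → sum (f ∘ nxt k) ≡ sum f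
  sum-rotate f = begin
    sum (f ∘ nxt k)                                                 ≡⟨ sum-init-last (f ∘ nxt k) ⟩
    sum (f ∘ nxt k ∘ Fin.inject₁) + f (nxt k (Fin.fromℕ (2 ℕ.+ k)))
      ≡⟨ cong₂ _+_ (sum-cong-≗ (cong f ∘ nxt-inject₁)) (cong f nxt-last) ⟩
    sum (f ∘ Fin.suc) + f 0F                                        ≡⟨ ℤ.+-comm _ (f 0F) ⟩
    sum f                                                           ∎

infix 4 _≡_mod_ _≡ᵖ_mod_

record _≡_mod_ (a b m : ℤ) : Set where
  constructor congruent
  field divides-difference : m ∣ a - b

_≟_mod_ : ∀ a b m → Dec (a ≡ b mod m)
_≟_mod_ a b m =
  map′ (congruent ∘ ∣ᵤ⇒∣) (∣⇒∣ᵤ ∘ _≡_mod_.divides-difference) (∣ m ∣ ℕ.∣? ∣ a - b ∣)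

_≡ᵖ_mod_ : Point → Point → ℤ → Set
_≡ᵖ_mod_ (x , y) (x′ , y′) m = x ≡ x′ mod m × y ≡ y′ mod m

module _ {m : ℤ} where

  mod-refl : ∀ {a} → a ≡ a mod m
  mod-refl {a} = congruent (divides (+ 0) (trans (ℤ.+-inverseʳ a) (sym (ℤ.*-zeroˡ m))))

  mod-trans : ∀ {a b c} → a ≡ b mod m → b ≡ c mod m → a ≡ c mod m
  mod-trans {a} {b} {c} (congruent p) (congruent q) = congruent (subst (m ∣_) (split a b c) (∣m∣n⇒∣m+n p q))
    where split : ∀ a b c → (a - b) + (b - c) ≡ a - c
          split = solve-∀

  +-cong-mod : ∀ {a b c d} → a ≡ b mod m → c ≡ d mod m → a + c ≡ b + d mod m
  +-cong-mod {a} {b} {c} {d} (congruent p) (congruent q) = congruent (subst (m ∣_) (split a b c d) (∣m∣n⇒∣m+n p q))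
    where split : ∀ a b c d → (a - b) + (c - d) ≡ (a + c) - (b + d)
          split = solve-∀

  sub-cong-mod : ∀ {a b c d} → a ≡ b mod m → c ≡ d mod m → a - c ≡ b - d mod m
  sub-cong-mod {a} {b} {c} {d} (congruent p) (congruent q) =
    congruent (subst (m ∣_) (split a b c d) (∣m∣n⇒∣m+n p (∣n⇒∣m*n -1ℤ q)))
    where split : ∀ a b c d → (a - b) + -1ℤ * (c - d) ≡ (a - c) - (b - d)
          split = solve-∀

  *-cong-mod : ∀ {a b c d} → a ≡ b mod m → c ≡ d mod m → a * c ≡ b * d mod m
  *-cong-mod {a} {b} {c} {d} (congruent p) (congruent q) =
    congruent (subst (m ∣_) (split a b c d) (∣m∣n⇒∣m+n (∣m⇒∣m*n c p) (∣n⇒∣m*n b q)))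
    where split : ∀ a b c d → (a - b) * c + b * (c - d) ≡ a * c - b * d
          split = solve-∀

  sum-cong-mod : ∀ {n} {f g : Vector ℤ n} → (∀ i → f i ≡ g i mod m) → sum f ≡ sum g mod m
  sum-cong-mod {ℕ.zero}  f≡g = mod-refl
  sum-cong-mod {ℕ.suc n} f≡g = +-cong-mod (f≡g 0F) (sum-cong-mod (f≡g ∘ Fin.suc))

edgeSum : (k : ℕ) → (Fin (3 ℕ.+ k) → Point) → (Point → Point → ℤ) → ℤ
edgeSum k V f = sum (λ i → f (V i) (V (nxt k i)))

module _ (k : ℕ) (V : Fin (3 ℕ.+ k) → Point) where

  edgeSum-cong : ∀ {f g} → (∀ P Q → f P Q ≡ g P Q) → edgeSum k V f ≡ edgeSum k V g
  edgeSum-cong f≡g = sum-cong-≗ (λ i → f≡g (V i) (V (nxt k i)))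

  edgeSum-cong-mod : ∀ {m f g} → (∀ P Q → f P Q ≡ g P Q mod m) → edgeSum k V f ≡ edgeSum k V g mod m
  edgeSum-cong-mod f≡g = sum-cong-mod (λ i → f≡g (V i) (V (nxt k i)))

  edgeSum-+ : ∀ f g → edgeSum k V (λ P Q → f P Q + g P Q) ≡ edgeSum k V f + edgeSum k V g
  edgeSum-+ f g = ∑-distrib-+ (λ i → f (V i) (V (nxt k i))) (λ i → g (V i) (V (nxt k i)))

  edgeSum-- : ∀ f g → edgeSum k V (λ P Q → f P Q - g P Q) ≡ edgeSum k V f - edgeSum k V g
  edgeSum-- f g = trans (edgeSum-+ f (λ P Q → - g P Q)) (cong (_+_ (edgeSum k V f)) (sum-neg (λ i → g (V i) (V (nxt k i)))))

  edgeSum-*ˡ : ∀ c f → edgeSum k V (λ P Q → c * f P Q) ≡ c * edgeSum k V f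
  edgeSum-*ˡ c f = sym (*-distribˡ-sum c (λ i → f (V i) (V (nxt k i))))

  edgeSum-*ʳ : ∀ c f → edgeSum k V (λ P Q → f P Q * c) ≡ edgeSum k V f * c
  edgeSum-*ʳ c f = sym (*-distribʳ-sum c (λ i → f (V i) (V (nxt k i))))

  edgeSum-coboundary : ∀ G → edgeSum k V (λ P Q → G Q - G P) ≡ + 0
  edgeSum-coboundary G = begin
    edgeSum k V (λ P Q → G Q - G P)            ≡⟨ edgeSum-- (λ _ Q → G Q) (λ P _ → G P) ⟩
    sum (G ∘ V ∘ nxt k) - sum (G ∘ V)          ≡⟨ cong (_- sum (G ∘ V)) (sum-rotate k (G ∘ V)) ⟩
    sum (G ∘ V) - sum (G ∘ V)                  ≡⟨ ℤ.+-inverseʳ (sum (G ∘ V)) ⟩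
    + 0                                        ∎

  edgeSum-odd : IsBalanced k V → ∀ g → (∀ v → g (-ᵖ v) ≡ - g v) → edgeSum k V (λ P Q → g (Q -ᵖ P)) ≡ + 0
  edgeSum-odd (π , π∘π≡id , _ , edge∘π≡-edge) g g-odd = i≡-i⇒i≡0 _ (begin
    sum (g ∘ edge k V)                         ≡⟨ sum-involution π π∘π≡id (g ∘ edge k V) ⟨
    sum (g ∘ edge k V ∘ π)
      ≡⟨ sum-cong-≗ (λ i → trans (cong g (edge∘π≡-edge i)) (g-odd (edge k V i))) ⟩
    sum (λ i → - g (edge k V i))               ≡⟨ sum-neg (g ∘ edge k V) ⟩
    - sum (g ∘ edge k V)                       ∎)

∀-K4V? : {P : K4V → Set} → (∀ v → Dec (P v)) → Dec (∀ v → P v)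
∀-K4V? P? = map′ (λ h (a , b) → h a b) (λ h a b → h (a , b)) (Fin.all? λ a → Fin.all? λ b → P? (a , b))

∀-K4V⁴? : {P : K4V → K4V → K4V → K4V → Set} → (∀ p q x y → Dec (P p q x y)) → Dec (∀ p q x y → P p q x y)
∀-K4V⁴? P? = ∀-K4V? λ p → ∀-K4V? λ q → ∀-K4V? λ x → ∀-K4V? λ y → P? p q x y

-- Coordinates, in the basis σ₁ σ₂ σ₃, of the cycle X₁ → p → q → X₁ closing the edge p q
-- through the spanning star at X₁.
coeff₁ coeff₂ coeff₃ : K4V → K4V → ℤ
coeff₁ (0F , 1F) (1F , 0F) = 1ℤ
coeff₁ (1F , 0F) (0F , 1F) = -1ℤ
coeff₁ (0F , 1F) (1F , 1F) = 1ℤ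
coeff₁ (1F , 1F) (0F , 1F) = -1ℤ
coeff₁ _         _         = + 0
coeff₂ (1F , 0F) (1F , 1F) = 1ℤ
coeff₂ (1F , 1F) (1F , 0F) = -1ℤ
coeff₂ (0F , 1F) (1F , 1F) = 1ℤ
coeff₂ (1F , 1F) (0F , 1F) = -1ℤ
coeff₂ _         _         = + 0
coeff₃ (0F , 1F) (1F , 1F) = 1ℤ
coeff₃ (1F , 1F) (0F , 1F) = -1ℤ
coeff₃ _         _         = + 0

seg-decomposition : ∀ p q x y →
  seg p q x y ≡ (seg X₁ q x y - seg X₁ p x y)
                + (coeff₁ p q * σ₁ x y + coeff₂ p q * σ₂ x y + coeff₃ p q * σ₃ x y)
seg-decomposition = toWitness {a? = ∀-K4V⁴? λ _ _ _ _ → _ ℤ.≟ _} _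

reduced : (K4V → K4V → ℤ) → Point → Point → ℤ
reduced c P Q = c (red P) (red Q)

reducedEdgeSum : (k : ℕ) → (Fin (3 ℕ.+ k) → Point) → (K4V → K4V → ℤ) → ℤ
reducedEdgeSum k V c = edgeSum k V (reduced c)

⟨⟩-σ-expansion : ∀ k V x y →
  ⟨ V ⟩ x y ≡ reducedEdgeSum k V coeff₁ * σ₁ x y + reducedEdgeSum k V coeff₂ * σ₂ x y
                + reducedEdgeSum k V coeff₃ * σ₃ x y
⟨⟩-σ-expansion k V x y = begin
  ⟨ V ⟩ x y
    ≡⟨ Σℤ≡sum _ (λ i → seg (red (V i)) (red (V (nxt k i))) x y) ⟩
  edgeSum k V (λ P Q → seg (red P) (red Q) x y)
    ≡⟨ edgeSum-cong k V (λ P Q → seg-decomposition (red P) (red Q) x y) ⟩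
  edgeSum k V (λ P Q → (star Q - star P) + σ-part P Q)
    ≡⟨ edgeSum-+ k V (λ P Q → star Q - star P) σ-part ⟩
  edgeSum k V (λ P Q → star Q - star P) + edgeSum k V σ-part
    ≡⟨ cong (_+ edgeSum k V σ-part) (edgeSum-coboundary k V star) ⟩
  + 0 + edgeSum k V σ-part
    ≡⟨ ℤ.+-identityˡ _ ⟩
  edgeSum k V σ-part
    ≡⟨ edgeSum-+ k V (λ P Q → term₁ P Q + term₂ P Q) term₃ ⟩
  edgeSum k V (λ P Q → term₁ P Q + term₂ P Q) + edgeSum k V term₃
    ≡⟨ cong (_+ edgeSum k V term₃) (edgeSum-+ k V term₁ term₂) ⟩
  edgeSum k V term₁ + edgeSum k V term₂ + edgeSum k V term₃
    ≡⟨ cong₂ _+_ (cong₂ _+_ (edgeSum-*ʳ k V (σ₁ x y) (reduced coeff₁)) (edgeSum-*ʳ k V (σ₂ x y) (reduced coeff₂)))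
                 (edgeSum-*ʳ k V (σ₃ x y) (reduced coeff₃)) ⟩
  reducedEdgeSum k V coeff₁ * σ₁ x y + reducedEdgeSum k V coeff₂ * σ₂ x y + reducedEdgeSum k V coeff₃ * σ₃ x y
    ∎
  where
  star : Point → ℤ
  star P = seg X₁ (red P) x y
  term₁ term₂ term₃ σ-part : Point → Point → ℤ
  term₁ P Q = reduced coeff₁ P Q * σ₁ x y
  term₂ P Q = reduced coeff₂ P Q * σ₂ x y
  term₃ P Q = reduced coeff₃ P Q * σ₃ x y
  σ-part P Q = term₁ P Q + term₂ P Q + term₃ P Q

fromDigits : Fin 2 → Fin 2 → ℤ
fromDigits d₀ d₁ = + Fin.toℕ d₀ + + 2 * + Fin.toℕ d₁

toℕ-red₂ : ∀ z → Fin.toℕ (red₂ z) ≡ z %ℕ 2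
toℕ-red₂ z = trans (Fin.toℕ-fromℕ< _) (ℕ.m<n⇒m%n≡m (n%ℕd<d z 2))

fromDigits-mod4 : ∀ z → z ≡ fromDigits (red₂ z) (red₂ (z /ℕ 2)) mod + 4
fromDigits-mod4 z = congruent (divides t (begin
  z - fromDigits (red₂ z) (red₂ (z /ℕ 2))
    ≡⟨ cong₂ _-_ expand (cong₂ (λ a b → + a + + 2 * + b) (toℕ-red₂ z) (toℕ-red₂ q)) ⟩
  (r₀ + (r₁ + t * + 2) * + 2) - (r₀ + + 2 * r₁) ≡⟨ cancel r₀ r₁ t ⟩
  t * + 4                                     ∎))
  where
  q = z /ℕ 2
  r₀ = + (z %ℕ 2)
  r₁ = + (q %ℕ 2)
  t = q /ℕ 2
  expand : z ≡ r₀ + (r₁ + t * + 2) * + 2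
  expand = trans (a≡a%ℕn+[a/ℕn]*n z 2) (cong (λ u → r₀ + u * + 2) (a≡a%ℕn+[a/ℕn]*n q 2))
  cancel : ∀ r₀ r₁ t → (r₀ + (r₁ + t * + 2) * + 2) - (r₀ + + 2 * r₁) ≡ t * + 4
  cancel = solve-∀

high : Point → K4V
high (x , y) = (red₂ (x /ℕ 2) , red₂ (y /ℕ 2))

residue₄ : K4V → K4V → Point
residue₄ (a , b) (a′ , b′) = (fromDigits a a′ , fromDigits b b′)

point-mod4 : ∀ P → P ≡ᵖ residue₄ (red P) (high P) mod + 4
point-mod4 (x , y) = fromDigits-mod4 x , fromDigits-mod4 y

cubic : ℤ → Point → ℤ
cubic s (x , y) = x * x * y - s * (x * y * y)

twistedWedge : ℤ → Point → Point → ℤ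
twistedWedge s P Q = P ∧ Q - (cubic s Q - cubic s P) - cubic s (Q -ᵖ P)

cubic-odd : ∀ s v → cubic s (-ᵖ v) ≡ - cubic s v
cubic-odd s (x , y) = odd s x y
  where odd : ∀ s x y → (- x) * (- x) * (- y) - s * ((- x) * (- y) * (- y)) ≡ - (x * x * y - s * (x * y * y))
        odd = solve-∀

module _ {m : ℤ} {P P′ Q Q′ : Point} (P≡P′ : P ≡ᵖ P′ mod m) (Q≡Q′ : Q ≡ᵖ Q′ mod m) where

  ∧-cong-mod : P ∧ Q ≡ P′ ∧ Q′ mod m
  ∧-cong-mod = sub-cong-mod (*-cong-mod (proj₁ P≡P′) (proj₂ Q≡Q′)) (*-cong-mod (proj₂ P≡P′) (proj₁ Q≡Q′))

  -ᵖ-cong-mod : Q -ᵖ P ≡ᵖ Q′ -ᵖ P′ mod m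
  -ᵖ-cong-mod = sub-cong-mod (proj₁ Q≡Q′) (proj₁ P≡P′) , sub-cong-mod (proj₂ Q≡Q′) (proj₂ P≡P′)

cubic-cong-mod : ∀ s {m P P′} → P ≡ᵖ P′ mod m → cubic s P ≡ cubic s P′ mod m
cubic-cong-mod s (x≡ , y≡) =
  sub-cong-mod (*-cong-mod (*-cong-mod x≡ x≡) y≡) (*-cong-mod (mod-refl {a = s}) (*-cong-mod (*-cong-mod x≡ y≡) y≡))

twistedWedge-cong-mod : ∀ s {m P P′ Q Q′} → P ≡ᵖ P′ mod m → Q ≡ᵖ Q′ mod m →
                        twistedWedge s P Q ≡ twistedWedge s P′ Q′ mod m
twistedWedge-cong-mod s P≡P′ Q≡Q′ =
  sub-cong-mod
    (sub-cong-mod (∧-cong-mod P≡P′ Q≡Q′) (sub-cong-mod (cubic-cong-mod s Q≡Q′) (cubic-cong-mod s P≡P′)))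
    (cubic-cong-mod s (-ᵖ-cong-mod P≡P′ Q≡Q′))

coeffSum : K4V → K4V → ℤ
coeffSum p q = coeff₁ p q + coeff₂ p q + coeff₃ p q

twistedWedge-residues : ∀ (s : Sign) p p′ q q′ →
  twistedWedge (s ◃ 1) (residue₄ p p′) (residue₄ q q′) ≡ (s ◃ 1) * coeffSum p q mod + 4
twistedWedge-residues Sign.+ = toWitness {a? = ∀-K4V⁴? λ _ _ _ _ → _ ≟ _ mod _} _
twistedWedge-residues Sign.- = toWitness {a? = ∀-K4V⁴? λ _ _ _ _ → _ ≟ _ mod _} _

twistedWedge-mod4 : ∀ (s : Sign) P Q → twistedWedge (s ◃ 1) P Q ≡ (s ◃ 1) * reduced coeffSum P Q mod + 4
twistedWedge-mod4 s P Q = mod-trans (twistedWedge-cong-mod (s ◃ 1) (point-mod4 P) (point-mod4 Q))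
                                    (twistedWedge-residues s (red P) (high P) (red Q) (high Q))

module _ (k : ℕ) (V : Fin (3 ℕ.+ k) → Point) where

  reducedEdgeSum-coeffSum : reducedEdgeSum k V coeffSum
                            ≡ reducedEdgeSum k V coeff₁ + reducedEdgeSum k V coeff₂ + reducedEdgeSum k V coeff₃
  reducedEdgeSum-coeffSum =
    trans (edgeSum-+ k V (λ P Q → reduced coeff₁ P Q + reduced coeff₂ P Q) (reduced coeff₃))
          (cong (_+ reducedEdgeSum k V coeff₃) (edgeSum-+ k V (reduced coeff₁) (reduced coeff₂)))

  edgeSum-twistedWedge : IsBalanced k V → ∀ s → edgeSum k V (twistedWedge s) ≡ doubleArea k V
  edgeSum-twistedWedge balanced s = begin
    edgeSum k V (twistedWedge s)
      ≡⟨ edgeSum-- k V (λ P Q → P ∧ Q - coboundary P Q) odd ⟩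
    edgeSum k V (λ P Q → P ∧ Q - coboundary P Q) - edgeSum k V odd
      ≡⟨ cong₂ _-_ (edgeSum-- k V _∧_ coboundary) (edgeSum-odd k V balanced (cubic s) (cubic-odd s)) ⟩
    edgeSum k V _∧_ - edgeSum k V coboundary - + 0
      ≡⟨ ℤ.+-identityʳ _ ⟩
    edgeSum k V _∧_ - edgeSum k V coboundary
      ≡⟨ cong (_-_ (edgeSum k V _∧_)) (edgeSum-coboundary k V (cubic s)) ⟩
    edgeSum k V _∧_ - + 0
      ≡⟨ ℤ.+-identityʳ _ ⟩
    edgeSum k V _∧_
      ≡⟨ Σℤ≡sum _ (λ i → V i ∧ V (nxt k i)) ⟨
    doubleArea k V
      ∎
    where
    coboundary odd : Point → Point → ℤ
    coboundary P Q = cubic s Q - cubic s P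
    odd P Q = cubic s (Q -ᵖ P)

  doubleArea-mod4 : IsBalanced k V → ∀ (s : Sign) →
    doubleArea k V
      ≡ (s ◃ 1) * (reducedEdgeSum k V coeff₁ + reducedEdgeSum k V coeff₂ + reducedEdgeSum k V coeff₃) mod + 4
  doubleArea-mod4 balanced s =
    subst₂ (_≡_mod + 4)
      (edgeSum-twistedWedge balanced (s ◃ 1))
      (trans (edgeSum-*ˡ k V (s ◃ 1) (reduced coeffSum)) (cong (_*_ (s ◃ 1)) reducedEdgeSum-coeffSum))
      (edgeSum-cong-mod k V (twistedWedge-mod4 s))

≡±-mod-4⇒even : ∀ {X A} → X ≡ 1ℤ * A mod + 4 → X ≡ -1ℤ * A mod + 4 →
                ∃[ S ] (A ≡ + 2 * S) × (∃[ t ] X ≡ + 2 * S + + 4 * t)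
≡±-mod-4⇒even {X} {A} (congruent (divides q₊ X-A≡4q₊)) (congruent (divides q₋ X+A≡4q₋)) =
  S , A≡2S , q₊ , (begin
    X                     ≡⟨ split X A ⟩
    1ℤ * A + (X - 1ℤ * A) ≡⟨ cong₂ _+_ (ℤ.*-identityˡ A) X-A≡4q₊ ⟩
    A + q₊ * + 4          ≡⟨ cong₂ _+_ A≡2S (ℤ.*-comm q₊ (+ 4)) ⟩
    + 2 * S + + 4 * q₊    ∎)
  where
  S = q₋ - q₊
  2A≡2[2S] : + 2 * A ≡ + 2 * (+ 2 * S)
  2A≡2[2S] = begin
    + 2 * A                      ≡⟨ twice A X ⟩
    (X - -1ℤ * A) - (X - 1ℤ * A) ≡⟨ cong₂ _-_ X+A≡4q₋ X-A≡4q₊ ⟩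
    q₋ * + 4 - q₊ * + 4          ≡⟨ quadruple q₋ q₊ ⟩
    + 2 * (+ 2 * S)              ∎
    where twice : ∀ A X → + 2 * A ≡ (X - -1ℤ * A) - (X - 1ℤ * A)
          twice = solve-∀
          quadruple : ∀ q₋ q₊ → q₋ * + 4 - q₊ * + 4 ≡ + 2 * (+ 2 * (q₋ - q₊))
          quadruple = solve-∀
  A≡2S : A ≡ + 2 * S
  A≡2S = ℤ.*-cancelˡ-≡ (+ 2) A (+ 2 * S) 2A≡2[2S]
  split : ∀ X A → X ≡ 1ℤ * A + (X - 1ℤ * A)
  split = solve-∀

module _ {a₁ a₂ a₃ S : ℤ} (a₁+a₂+a₃≡2S : a₁ + a₂ + a₃ ≡ + 2 * S) where

  private
    defect≡0 : + 2 * S - (a₁ + a₂ + a₃) ≡ + 0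
    defect≡0 = trans (cong (_-_ (+ 2 * S)) a₁+a₂+a₃≡2S) (ℤ.+-inverseʳ (+ 2 * S))

    drop-defect : ∀ x y → x + (+ 2 * S - (a₁ + a₂ + a₃)) * y ≡ x
    drop-defect x y = begin
      x + (+ 2 * S - (a₁ + a₂ + a₃)) * y ≡⟨ cong (λ d → x + d * y) defect≡0 ⟩
      x + + 0 * y                         ≡⟨ cong (_+_ x) (ℤ.*-zeroˡ y) ⟩
      x + + 0                             ≡⟨ ℤ.+-identityʳ x ⟩
      x                                   ∎

  σ-rebase : ∀ u v w → a₁ * u + a₂ * v + a₃ * w ≡ (S - a₁) * (v + w) + (S - a₂) * (w + u) + (S - a₃) * (u + v)
  σ-rebase u v w = sym (trans (expand a₁ a₂ a₃ S u v w) (drop-defect _ (u + v + w)))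
    where expand : ∀ a₁ a₂ a₃ S u v w → (S - a₁) * (v + w) + (S - a₂) * (w + u) + (S - a₃) * (u + v)
                     ≡ a₁ * u + a₂ * v + a₃ * w + (+ 2 * S - (a₁ + a₂ + a₃)) * (u + v + w)
          expand = solve-∀

  rebased-sum : S - a₁ + (S - a₂) + (S - a₃) ≡ S
  rebased-sum = trans (expand a₁ a₂ a₃ S) (drop-defect S (+ 1))
    where expand : ∀ a₁ a₂ a₃ S → S - a₁ + (S - a₂) + (S - a₃) ≡ S + (+ 2 * S - (a₁ + a₂ + a₃)) * + 1
          expand = solve-∀

lemma5 : (k : ℕ) (V : Fin (3 Data.Nat.+ k) → Point) →
    IsSimple k V → IsClockwise k V → IsBalanced k V →
    ∃[ μ₁ ] ∃[ μ₂ ] ∃[ μ₃ ]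
      ((∀ x y → ⟨ V ⟩ x y ≡ (μ₁ ⊙ (σ₂ ⊕ σ₃) ⊕ μ₂ ⊙ (σ₃ ⊕ σ₁) ⊕ μ₃ ⊙ (σ₁ ⊕ σ₂)) x y) ×
       (∃[ t ] doubleArea k V ≡ + 2 * (μ₁ + μ₂ + μ₃) + + 4 * t))
lemma5 k V _ _ balanced =
  let a₁ = reducedEdgeSum k V coeff₁
      a₂ = reducedEdgeSum k V coeff₂
      a₃ = reducedEdgeSum k V coeff₃
      (S , a₁+a₂+a₃≡2S , t , area≡2S+4t) =
        ≡±-mod-4⇒even (doubleArea-mod4 k V balanced Sign.+) (doubleArea-mod4 k V balanced Sign.-)
  in S - a₁ , S - a₂ , S - a₃ ,
     (λ x y → trans (⟨⟩-σ-expansion k V x y) (σ-rebase a₁+a₂+a₃≡2S (σ₁ x y) (σ₂ x y) (σ₃ x y))) ,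
     (t , trans area≡2S+4t (cong (λ μ → + 2 * μ + + 4 * t) (sym (rebased-sum a₁+a₂+a₃≡2S))))
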